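{- The edge Folkman number $F_e(K_3,K_3;K_1+P_4)$ does not exist; that is, for every $(K_1+P_4)$-free graph $G$ there is a red-blue coloring of the edges of $G$ with no monochromatic triangle.
   Context: All graphs are finite, undirected and simple. $P_4$ is the path on $4$ vertices; the join $K_1+P_4$ is obtained by adding a vertex adjacent to all vertices of $P_4$. A graph is $H$-free if it contains no subgraph isomorphic to $H$. $F_e(K_3,K_3;H)$ is the smallest $n$ such that some $H$-free graph on $n$ vertices has every red-blue edge coloring containing a monochromatic $K_3$; it "exists" if such a graph exists. -}

module Defs where

open import Data.Nat using (ℕ)
open import Data.Fin using (Fin; zero; suc)
open import Data.Bool using (Bool; true; false)
open import Data.Product using (Σ; _×_; ∃-syntax)
open import Relation.Binary.PropositionalEquality using (_≡_; _≢_)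
open import Relation.Nullary using (¬_)
open import Function.Definitions using (Injective)

record Graph (n : ℕ) : Set where
  field
    adj   : Fin n → Fin n → Bool
    sym   : ∀ u v → adj u v ≡ adj v u
    irref : ∀ v → adj v v ≡ false
open Graph public

Edge : ∀ {n} → Graph n → Fin n → Fin n → Set
Edge G u v = adj G u v ≡ true

_⊆ᵍ_ : ∀ {m n} → Graph m → Graph n → Set
_⊆ᵍ_ {m} {n} H G =
  Σ (Fin m → Fin n) λ f → Injective _≡_ _≡_ f × (∀ u v → Edge H u v → Edge G (f u) (f v))

_-free_ : ∀ {m n} → Graph m → Graph n → Set
H -free G = ¬ (H ⊆ᵍ G)

-- K₁ + P₄: vertex 0 is the apex, vertices 1-2-3-4 form the path P₄.
k1p4adj : Fin 5 → Fin 5 → Bool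
k1p4adj zero zero = false
k1p4adj zero (suc _) = true
k1p4adj (suc _) zero = true
k1p4adj (suc zero) (suc (suc zero)) = true
k1p4adj (suc (suc zero)) (suc zero) = true
k1p4adj (suc (suc zero)) (suc (suc (suc zero))) = true
k1p4adj (suc (suc (suc zero))) (suc (suc zero)) = true
k1p4adj (suc (suc (suc zero))) (suc (suc (suc (suc zero)))) = true
k1p4adj (suc (suc (suc (suc zero)))) (suc (suc (suc zero))) = true
k1p4adj (suc _) (suc _) = false

K1+P4 : Graph 5
K1+P4 = record { adj = k1p4adj ; sym = s ; irref = i }
  where
  s : ∀ u v → k1p4adj u v ≡ k1p4adj v u
  s zero zero = _≡_.refl
  s zero (suc v) = _≡_.refl
  s (suc u) zero = _≡_.refl
  s (suc zero) (suc zero) = _≡_.refl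
  s (suc zero) (suc (suc zero)) = _≡_.refl
  s (suc zero) (suc (suc (suc zero))) = _≡_.refl
  s (suc zero) (suc (suc (suc (suc zero)))) = _≡_.refl
  s (suc (suc zero)) (suc zero) = _≡_.refl
  s (suc (suc zero)) (suc (suc zero)) = _≡_.refl
  s (suc (suc zero)) (suc (suc (suc zero))) = _≡_.refl
  s (suc (suc zero)) (suc (suc (suc (suc zero)))) = _≡_.refl
  s (suc (suc (suc zero))) (suc zero) = _≡_.refl
  s (suc (suc (suc zero))) (suc (suc zero)) = _≡_.refl
  s (suc (suc (suc zero))) (suc (suc (suc zero))) = _≡_.refl
  s (suc (suc (suc zero))) (suc (suc (suc (suc zero)))) = _≡_.refl
  s (suc (suc (suc (suc zero)))) (suc zero) = _≡_.refl
  s (suc (suc (suc (suc zero)))) (suc (suc zero)) = _≡_.refl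
  s (suc (suc (suc (suc zero)))) (suc (suc (suc zero))) = _≡_.refl
  s (suc (suc (suc (suc zero)))) (suc (suc (suc (suc zero)))) = _≡_.refl
  i : ∀ v → k1p4adj v v ≡ false
  i zero = _≡_.refl
  i (suc zero) = _≡_.refl
  i (suc (suc zero)) = _≡_.refl
  i (suc (suc (suc zero))) = _≡_.refl
  i (suc (suc (suc (suc zero)))) = _≡_.refl

-- A red-blue edge colouring of G: a symmetric Bool-valued function on
-- vertex pairs (its values on non-edges are irrelevant).
record EdgeColouring {n : ℕ} (G : Graph n) : Set where
  field
    col    : Fin n → Fin n → Bool
    colSym : ∀ u v → col u v ≡ col v u
open EdgeColouring public

-- A monochromatic triangle: three (hence distinct) pairwise adjacent
-- vertices whose three edges all get the same colour.
MonoTriangle : ∀ {n} {G : Graph n} → EdgeColouring G → Set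
MonoTriangle {n} {G} c =
  ∃[ x ] ∃[ y ] ∃[ z ] ∃[ b ]
    (Edge G x y × Edge G y z × Edge G x z ×
     col c x y ≡ b × col c y z ≡ b × col c x z ≡ b)

-- Colour an edge uv red when it is heavy (u and v have two distinct non-adjacent
-- common neighbours) or bridged (some common neighbour w lies strictly between u
-- and v in the vertex order, with uw and vw not heavy), and blue otherwise.
-- A blue triangle a < m < c is impossible: its light edges am and mc bridge ac.
-- For red triangles the key fact is that if x, y have a common neighbour w other
-- than z in a triangle xyz, then xz is not heavy, since otherwise x is the apex of
-- a K₁ + P₄ over a path v z y w. Hence two heavy edges never meet in a triangle and
-- a bridged edge makes the two other edges of its triangle light, so in a red
-- triangle a < m < c the edges am and mc are light and bridged, by a < w < m and
-- m < w′ < c. Lightness then makes a w′ w c a path in the neighbourhood of m.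
module Submission where

open import Defs hiding (sym)
open import Data.Nat using (ℕ)
open import Data.Bool using (true; false)
open import Data.Bool.Properties using (T-≡; T-not-≡) renaming (_≟_ to _≟ᵇ_)
open import Data.Empty using (⊥; ⊥-elim)
open import Data.Fin using (Fin; zero; suc; _<_)
open import Data.Fin.Properties using (any?; <-cmp; <-trans; <-asym; <⇒≢; _<?_; _≟_)
open import Data.Product using (∃-syntax; _×_; _,_)
open import Data.Sum using (_⊎_; inj₁; inj₂)
open import Data.Vec using ([]; _∷_; lookup)
open import Data.Vec.Relation.Unary.All using ([]; _∷_)
open import Data.Vec.Relation.Unary.AllPairs using ([]; _∷_)
open import Data.Vec.Relation.Unary.Unique.Propositional using (Unique)
open import Data.Vec.Relation.Unary.Unique.Propositional.Properties using (lookup-injective)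
open import Function.Bundles using (mk⇔; Equivalence)
open import Level using (Level)
open import Relation.Binary using (Rel; Symmetric; Irreflexive; Trichotomous; tri<; tri≈; tri>)
open import Relation.Binary.PropositionalEquality using (_≡_; _≢_; refl; sym; trans)
open import Relation.Nullary using (¬_; Dec; yes; no; does)
open import Relation.Nullary.Decidable using (_×-dec_; _⊎-dec_; ¬?; does-⇔; isYes≗does; toWitness; toWitnessFalse)

module _ {a ℓ : Level} {A : Set a} where

  TriangleOf : Rel A ℓ → A → A → A → Set ℓ
  TriangleOf S x y z = S x y × S y z × S x z

  increasing-triangle : ∀ {ℓ′} {_<ₐ_ : Rel A ℓ′} → Trichotomous _≡_ _<ₐ_ →
    ∀ {S : Rel A ℓ} → Symmetric S → Irreflexive _≡_ S →
    ∀ {x y z} → TriangleOf S x y z →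
    ∃[ u ] ∃[ v ] ∃[ w ] (u <ₐ v × v <ₐ w × TriangleOf S u v w)
  increasing-triangle compare S-sym S-irr {x} {y} {z} t@(sxy , syz , sxz)
    with compare x y | compare y z | compare x z
  ... | tri≈ _ refl _ | _ | _ = ⊥-elim (S-irr refl sxy)
  ... | _ | tri≈ _ refl _ | _ = ⊥-elim (S-irr refl syz)
  ... | _ | _ | tri≈ _ refl _ = ⊥-elim (S-irr refl sxz)
  ... | tri< x<y _ _ | tri< y<z _ _ | _ = x , y , z , x<y , y<z , t
  ... | tri< _ _ _ | tri> _ _ z<y | tri< x<z _ _ = x , z , y , x<z , z<y , sxz , S-sym syz , sxy
  ... | tri< x<y _ _ | tri> _ _ _ | tri> _ _ z<x = z , x , y , z<x , x<y , S-sym sxz , sxy , S-sym syz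
  ... | tri> _ _ y<x | tri< _ _ _ | tri< x<z _ _ = y , x , z , y<x , x<z , S-sym sxy , sxz , syz
  ... | tri> _ _ _ | tri< y<z _ _ | tri> _ _ z<x = y , z , x , y<z , z<x , syz , S-sym sxz , S-sym sxy
  ... | tri> _ _ y<x | tri> _ _ z<y | _ = z , y , x , z<y , y<x , S-sym syz , S-sym sxy , S-sym sxz

module _ {n : ℕ} (G : Graph n) where

  private
    E : Fin n → Fin n → Set
    E = Edge G

  Edge? : ∀ u v → Dec (E u v)
  Edge? u v = adj G u v ≟ᵇ true

  Edge-sym : ∀ {u v} → E u v → E v u
  Edge-sym {u} {v} e = trans (Graph.sym G v u) e

  Edge⇒≢ : ∀ {u v} → E u v → u ≢ v
  Edge⇒≢ {u} e refl with trans (sym e) (irref G u)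
  ... | ()

  fan⇒K1+P4⊆ : ∀ {v p₁ p₂ p₃ p₄} →
    E v p₁ → E v p₂ → E v p₃ → E v p₄ → E p₁ p₂ → E p₂ p₃ → E p₃ p₄ →
    p₁ ≢ p₃ → p₂ ≢ p₄ → p₁ ≢ p₄ → K1+P4 ⊆ᵍ G
  fan⇒K1+P4⊆ {v} {p₁} {p₂} {p₃} {p₄} e₁ e₂ e₃ e₄ e₁₂ e₂₃ e₃₄ p₁≢p₃ p₂≢p₄ p₁≢p₄ =
    lookup vertices , (λ {i} {j} → lookup-injective distinct i j) , edges
    where
    vertices = v ∷ p₁ ∷ p₂ ∷ p₃ ∷ p₄ ∷ []

    distinct : Unique vertices
    distinct = (Edge⇒≢ e₁ ∷ Edge⇒≢ e₂ ∷ Edge⇒≢ e₃ ∷ Edge⇒≢ e₄ ∷ [])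
             ∷ (Edge⇒≢ e₁₂ ∷ p₁≢p₃ ∷ p₁≢p₄ ∷ [])
             ∷ (Edge⇒≢ e₂₃ ∷ p₂≢p₄ ∷ [])
             ∷ (Edge⇒≢ e₃₄ ∷ [])
             ∷ []
             ∷ []

    edges : ∀ i j → Edge K1+P4 i j → E (lookup vertices i) (lookup vertices j)
    edges zero zero ()
    edges zero (suc zero) _ = e₁
    edges zero (suc (suc zero)) _ = e₂
    edges zero (suc (suc (suc zero))) _ = e₃
    edges zero (suc (suc (suc (suc zero)))) _ = e₄
    edges (suc zero) zero _ = Edge-sym e₁
    edges (suc (suc zero)) zero _ = Edge-sym e₂
    edges (suc (suc (suc zero))) zero _ = Edge-sym e₃
    edges (suc (suc (suc (suc zero)))) zero _ = Edge-sym e₄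
    edges (suc zero) (suc zero) ()
    edges (suc zero) (suc (suc zero)) _ = e₁₂
    edges (suc zero) (suc (suc (suc zero))) ()
    edges (suc zero) (suc (suc (suc (suc zero)))) ()
    edges (suc (suc zero)) (suc zero) _ = Edge-sym e₁₂
    edges (suc (suc zero)) (suc (suc zero)) ()
    edges (suc (suc zero)) (suc (suc (suc zero))) _ = e₂₃
    edges (suc (suc zero)) (suc (suc (suc (suc zero)))) ()
    edges (suc (suc (suc zero))) (suc zero) ()
    edges (suc (suc (suc zero))) (suc (suc zero)) _ = Edge-sym e₂₃
    edges (suc (suc (suc zero))) (suc (suc (suc zero))) ()
    edges (suc (suc (suc zero))) (suc (suc (suc (suc zero)))) _ = e₃₄
    edges (suc (suc (suc (suc zero)))) (suc zero) ()
    edges (suc (suc (suc (suc zero)))) (suc (suc zero)) ()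
    edges (suc (suc (suc (suc zero)))) (suc (suc (suc zero))) _ = Edge-sym e₃₄
    edges (suc (suc (suc (suc zero)))) (suc (suc (suc (suc zero)))) ()

  non-edge-avoids-edge : ∀ {p q y w} → p ≢ q → ¬ E p q → E y w →
    (p ≢ y × p ≢ w) ⊎ (q ≢ y × q ≢ w)
  non-edge-avoids-edge {p} {q} {y} {w} p≢q ¬pq yw with p ≟ y | p ≟ w | q ≟ y | q ≟ w
  ... | no p≢y | no p≢w | _ | _ = inj₁ (p≢y , p≢w)
  ... | _ | _ | no q≢y | no q≢w = inj₂ (q≢y , q≢w)
  ... | yes refl | _ | yes refl | _ = ⊥-elim (p≢q refl)
  ... | _ | yes refl | _ | yes refl = ⊥-elim (p≢q refl)
  ... | yes refl | _ | _ | yes refl = ⊥-elim (¬pq yw)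
  ... | _ | yes refl | yes refl | _ = ⊥-elim (¬pq (Edge-sym yw))

  CommonNeighbour : Fin n → Fin n → Fin n → Set
  CommonNeighbour u v w = E u w × E v w

  CommonNeighbour? : ∀ u v w → Dec (CommonNeighbour u v w)
  CommonNeighbour? u v w = Edge? u w ×-dec Edge? v w

  Heavy : Fin n → Fin n → Set
  Heavy u v = ∃[ p ] ∃[ q ]
    (CommonNeighbour u v p × CommonNeighbour u v q × p ≢ q × ¬ E p q)

  Heavy? : ∀ u v → Dec (Heavy u v)
  Heavy? u v = any? λ p → any? λ q →
    CommonNeighbour? u v p ×-dec CommonNeighbour? u v q ×-dec ¬? (p ≟ q) ×-dec ¬? (Edge? p q)

  Heavy-sym : ∀ {u v} → Heavy u v → Heavy v u
  Heavy-sym (p , q , (up , vp) , (uq , vq) , p≢q , ¬pq) = p , q , (vp , up) , (vq , uq) , p≢q , ¬pq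

  light⇒common-neighbours-adjacent : ∀ {u v p q} → ¬ Heavy u v →
    CommonNeighbour u v p → CommonNeighbour u v q → p ≢ q → E p q
  light⇒common-neighbours-adjacent {p = p} {q} ¬h cp cq p≢q with Edge? p q
  ... | yes pq = pq
  ... | no ¬pq = ⊥-elim (¬h (p , q , cp , cq , p≢q , ¬pq))

  heavy⇒common-neighbour-avoiding : ∀ {u v y w} → Heavy u v → E y w →
    ∃[ p ] (CommonNeighbour u v p × p ≢ y × p ≢ w)
  heavy⇒common-neighbour-avoiding (p , q , cp , cq , p≢q , ¬pq) yw
    with non-edge-avoids-edge p≢q ¬pq yw
  ... | inj₁ avoids = p , cp , avoids
  ... | inj₂ avoids = q , cq , avoids

  Between : Fin n → Fin n → Fin n → Set
  Between u w v = (u < w × w < v) ⊎ (v < w × w < u)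

  Between? : ∀ u w v → Dec (Between u w v)
  Between? u w v = (u <? w ×-dec w <? v) ⊎-dec (v <? w ×-dec w <? u)

  Between-sym : ∀ {u w v} → Between u w v → Between v w u
  Between-sym (inj₁ ordered) = inj₂ ordered
  Between-sym (inj₂ ordered) = inj₁ ordered

  Bridged : Fin n → Fin n → Set
  Bridged u v = ∃[ w ] (CommonNeighbour u v w × Between u w v × ¬ Heavy u w × ¬ Heavy v w)

  Bridged? : ∀ u v → Dec (Bridged u v)
  Bridged? u v = any? λ w →
    CommonNeighbour? u v w ×-dec Between? u w v ×-dec ¬? (Heavy? u w) ×-dec ¬? (Heavy? v w)

  Bridged-sym : ∀ {u v} → Bridged u v → Bridged v u
  Bridged-sym (w , (uw , vw) , btw , ¬huw , ¬hvw) = w , (vw , uw) , Between-sym btw , ¬hvw , ¬huw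

  bridged⇒inner-common-neighbour : ∀ {u v} → u < v → Bridged u v →
    ∃[ w ] (CommonNeighbour u v w × u < w × w < v)
  bridged⇒inner-common-neighbour u<v (w , cw , inj₁ (u<w , w<v) , _) = w , cw , u<w , w<v
  bridged⇒inner-common-neighbour u<v (w , cw , inj₂ (v<w , w<u) , _) =
    ⊥-elim (<-asym u<v (<-trans v<w w<u))

  Red : Fin n → Fin n → Set
  Red u v = Heavy u v ⊎ Bridged u v

  Red? : ∀ u v → Dec (Red u v)
  Red? u v = Heavy? u v ⊎-dec Bridged? u v

  Red-sym : ∀ {u v} → Red u v → Red v u
  Red-sym (inj₁ h) = inj₁ (Heavy-sym h)
  Red-sym (inj₂ b) = inj₂ (Bridged-sym b)

  red-light⇒bridged : ∀ {u v} → Red u v → ¬ Heavy u v → Bridged u v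
  red-light⇒bridged (inj₁ h) ¬h = ⊥-elim (¬h h)
  red-light⇒bridged (inj₂ b) _ = b

  light-path⇒red : ∀ {a m c} → a < m → m < c → E a m → E m c →
    ¬ Heavy a m → ¬ Heavy m c → Red a c
  light-path⇒red a<m m<c am mc ¬ham ¬hmc =
    inj₂ (_ , (am , Edge-sym mc) , inj₁ (a<m , m<c) , ¬ham , λ h → ¬hmc (Heavy-sym h))

  colouring : EdgeColouring G
  colouring = record
    { col    = λ u v → does (Red? u v)
    ; colSym = λ u v → does-⇔ (mk⇔ Red-sym Red-sym) (Red? u v) (Red? v u)
    }

  red : ∀ {u v} → col colouring u v ≡ true → Red u v
  red {u} {v} eq = toWitness (Equivalence.from T-≡ (trans (isYes≗does (Red? u v)) eq))

  blue : ∀ {u v} → col colouring u v ≡ false → ¬ Red u v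
  blue {u} {v} eq = toWitnessFalse (Equivalence.from T-not-≡ (trans (isYes≗does (Red? u v)) eq))

  module _ (free : K1+P4 -free G) where

    extra-common-neighbour⇒¬heavy : ∀ {x y z w} → E x y → E y z → E x z →
      CommonNeighbour x y w → w ≢ z → ¬ Heavy x z
    extra-common-neighbour⇒¬heavy xy yz xz (xw , yw) w≢z h =
      let (v , (xv , zv) , v≢y , v≢w) = heavy⇒common-neighbour-avoiding h yw
      in free (fan⇒K1+P4⊆ xv xz xy xw (Edge-sym zv) (Edge-sym yz) yw
                 v≢y (λ z≡w → w≢z (sym z≡w)) v≢w)

    heavy⇒¬heavy : ∀ {x y z} → E x y → E y z → E x z → Heavy x y → ¬ Heavy x z
    heavy⇒¬heavy xy yz xz hxy =
      let (w , cw , _ , w≢z) = heavy⇒common-neighbour-avoiding hxy yz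
      in extra-common-neighbour⇒¬heavy xy yz xz cw w≢z

    bridged⇒¬heavy : ∀ {x y z} → E x y → E y z → E x z → Bridged x y → ¬ Heavy x z
    bridged⇒¬heavy {z = z} xy yz xz (w , cw , _ , ¬hxw , _) with w ≟ z
    ... | yes refl = ¬hxw
    ... | no w≢z = extra-common-neighbour⇒¬heavy xy yz xz cw w≢z

    ¬light-bridged-path : ∀ {a m c} → a < m → m < c → E a m → E m c → E a c →
      ¬ Heavy a m → ¬ Heavy m c → Bridged a m → Bridged m c → ⊥
    ¬light-bridged-path {a} {m} {c} a<m m<c am mc ac ¬ham ¬hmc bam bmc =
      let (w , (aw , mw) , a<w , w<m) = bridged⇒inner-common-neighbour a<m bam
          (w′ , (mw′ , cw′) , m<w′ , w′<c) = bridged⇒inner-common-neighbour m<c bmc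
          wc : E w c
          wc = light⇒common-neighbours-adjacent ¬ham (aw , mw) (ac , mc)
                 (<⇒≢ (<-trans w<m m<c))
          aw′ : E a w′
          aw′ = light⇒common-neighbours-adjacent ¬hmc (Edge-sym am , Edge-sym ac) (mw′ , cw′)
                  (<⇒≢ (<-trans a<m m<w′))
          w′w : E w′ w
          w′w = light⇒common-neighbours-adjacent ¬hmc (mw′ , cw′) (mw , Edge-sym wc)
                  (λ w′≡w → <⇒≢ (<-trans w<m m<w′) (sym w′≡w))
      in free (fan⇒K1+P4⊆ (Edge-sym am) mw′ mw mc aw′ w′w wc
                 (<⇒≢ a<w) (<⇒≢ w′<c) (<⇒≢ (<-trans a<m m<c)))

    ¬increasing-red-path : ∀ {a m c} → a < m → m < c → E a m → E m c → E a c →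
      Red a m → Red m c → ⊥
    ¬increasing-red-path {a} {m} {c} a<m m<c am mc ac ram rmc with Heavy? a m | rmc
    ... | yes ham | inj₁ hmc = heavy⇒¬heavy (Edge-sym am) ac mc (Heavy-sym ham) hmc
    ... | yes ham | inj₂ bmc = bridged⇒¬heavy mc (Edge-sym ac) (Edge-sym am) bmc (Heavy-sym ham)
    ... | no ¬ham | _ =
      ¬light-bridged-path a<m m<c am mc ac ¬ham ¬hmc bam (red-light⇒bridged rmc ¬hmc)
      where
      bam = red-light⇒bridged ram ¬ham
      ¬hmc : ¬ Heavy m c
      ¬hmc = bridged⇒¬heavy (Edge-sym am) ac mc (Bridged-sym bam)

    no-monochromatic-triangle : ¬ MonoTriangle colouring
    no-monochromatic-triangle (x , y , z , b , xy , yz , xz , bxy , byz , bxz)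
      with increasing-triangle <-cmp SameColour-sym SameColour-irrefl
             ((xy , bxy) , (yz , byz) , (xz , bxz))
      where
      SameColour : Fin n → Fin n → Set
      SameColour u v = E u v × col colouring u v ≡ b
      SameColour-sym : Symmetric SameColour
      SameColour-sym {u} {v} (uv , buv) = Edge-sym uv , trans (colSym colouring v u) buv
      SameColour-irrefl : Irreflexive _≡_ SameColour
      SameColour-irrefl refl (uu , _) = Edge⇒≢ uu refl
    ... | a , m , c , a<m , m<c , (am , bam) , (mc , bmc) , (ac , bac) with b
    ... | true = ¬increasing-red-path a<m m<c am mc ac (red bam) (red bmc)
    ... | false = blue bac (light-path⇒red a<m m<c am mc
                              (λ h → blue bam (inj₁ h)) (λ h → blue bmc (inj₁ h)))

theorem8 : (n : ℕ) (G : Graph n) → K1+P4 -free G →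
    ∃[ c ] ¬ MonoTriangle {n} {G} c
theorem8 n G free = colouring G , no-monochromatic-triangle G free
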